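{- Let $p$ be a prime, let $G \subseteq \mathrm{Sym}_n$ be a $p$-group, and let $\sigma,\tau \in G$ be elements of orders $p^e$ and $p^f$ respectively. Assume that the number of points of $\{1,\ldots,n\}$ with trivial stabilizer in $\langle\sigma\rangle$ (i.e., lying in an orbit of $\langle\sigma\rangle$ of length $p^e$) differs from the number of points of $\{1,\ldots,n\}$ with trivial stabilizer in $\langle\tau\rangle$ (i.e., lying in an orbit of $\langle\tau\rangle$ of length $p^f$). Then $p^{e+f}$ divides $\#G$. -}

module Defs where

open import Data.Nat using (ℕ; zero; suc; _<_; _^_)
open import Data.Fin using (Fin)
open import Data.Fin.Permutation using (Permutation′; _⟨$⟩ʳ_; _≈_; id; flip; _∘ₚ_)
open import Data.List using (List; length)
open import Data.List.Relation.Unary.Any using (Any)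
open import Data.List.Relation.Unary.AllPairs using (AllPairs)
open import Data.List.Membership.Propositional using (_∈_)
open import Data.List.Relation.Unary.Unique.Propositional using (Unique)
open import Data.Product using (Σ; _×_; ∃)
open import Relation.Binary.PropositionalEquality using (_≡_)
open import Relation.Nullary using (¬_)
open import Function.Bundles using (_⇔_)

_∈ₚ_ : ∀ {n} → Permutation′ n → List (Permutation′ n) → Set
σ ∈ₚ G = Any (λ ρ → ρ ≈ σ) G

-- A subgroup of Sym_n, given as a duplicate-free (up to ≈) list of its elements
record PermGroup (n : ℕ) : Set where
  field
    elems    : List (Permutation′ n)
    distinct : AllPairs (λ π ρ → ¬ (π ≈ ρ)) elems
    has-id   : id ∈ₚ elems
    closed-∘ : ∀ {π ρ} → π ∈ₚ elems → ρ ∈ₚ elems → (π ∘ₚ ρ) ∈ₚ elems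
    closed-⁻¹ : ∀ {π} → π ∈ₚ elems → flip π ∈ₚ elems

open PermGroup public

card : ∀ {n} → PermGroup n → ℕ
card G = length (elems G)

_∈G_ : ∀ {n} → Permutation′ n → PermGroup n → Set
σ ∈G G = σ ∈ₚ elems G

IsPGroup : ∀ {n} → ℕ → PermGroup n → Set
IsPGroup p G = ∃ λ k → card G ≡ p ^ k

pow : ∀ {n} → Permutation′ n → ℕ → Fin n → Fin n
pow σ zero    x = x
pow σ (suc k) x = σ ⟨$⟩ʳ (pow σ k x)

PowId : ∀ {n} → Permutation′ n → ℕ → Set
PowId {n} σ k = (y : Fin n) → pow σ k y ≡ y

HasOrder : ∀ {n} → Permutation′ n → ℕ → Set
HasOrder σ m = (0 < m) × PowId σ m × (∀ k → 0 < k → k < m → ¬ PowId σ k)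

-- x has trivial stabilizer in ⟨σ⟩
FreePoint : ∀ {n} → Permutation′ n → Fin n → Set
FreePoint σ x = ∀ k → pow σ k x ≡ x → PowId σ k

NumFree : ∀ {n} → Permutation′ n → ℕ → Set
NumFree {n} σ c = Σ (List (Fin n)) λ L →
  Unique L × (∀ x → (x ∈ L) ⇔ FreePoint σ x) × (length L ≡ c)

module Submission where

-- Write N = p^e and M = p^f for the orders of σ and τ.
-- Either the cyclic groups ⟨σ⟩ and ⟨τ⟩ meet trivially (every σ^i that equals
-- some τ^j is the identity), or some σ^i = τ^j ≠ 1.
--
--  * Trivial meet: the N·M products σ^i τ^j (i < N, j < M) are pairwise
--    distinct elements of G, so p^(e+f) ≤ #G = p^k, hence p^(e+f) ∣ #G.
--  * Nontrivial meet: then e, f ≥ 1, and a power of σ^i = τ^j is an element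
--    c ≠ 1 with c^p = 1.  In a cyclic p-group of order p^(e+1) every such c
--    has the same fixed points as σ^(p^e), and a point is free for ⟨σ⟩ iff
--    σ^(p^e) moves it.  Hence σ and τ have the same free points, so the two
--    counts agree — contradicting the hypothesis.

open import Defs
open import Data.Nat
  using (ℕ; zero; suc; _^_; _+_; _*_; _∸_; _<_; _≤_; z≤n; s≤s; NonZero; _%_; _/_; >-nonZero; nonTrivial⇒n>1)
open import Data.Nat.Properties
open import Data.Nat.DivMod using (m≡m%n+[m/n]*n; m%n<n; [m+kn]%n≡m%n; m<n⇒m%n≡m)
open import Data.Nat.Divisibility
open import Data.Nat.Primality using (Prime; prime⇒nonZero; prime⇒irreducible; prime⇒nonTrivial)
open import Data.Nat.Coprimality using (Coprime; coprime-divisor)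
open import Data.Nat.GCD using (gcd; gcd[m,n]∣m; gcd[m,n]∣n; gcd-GCD; module Bézout)
open import Data.Fin using (Fin; toℕ; remQuot; combine)
open import Data.Fin.Properties using (all?; injective⇒≤; combine-remQuot; toℕ<n; toℕ-injective)
  renaming (_≟_ to _≟ᶠ_)
open import Data.Fin.Permutation using (Permutation′; _⟨$⟩ʳ_; _≈_; id; _∘ₚ_)
open import Data.List using (List; lookup)
open import Data.List.Relation.Unary.Any using (Any; index)
open import Data.List.Relation.Unary.Any.Properties using (lookup-index)
open import Data.List.Membership.Propositional.Properties.WithK using (unique∧set⇒bag)
open import Data.List.Relation.Binary.BagAndSetEquality using (∼bag⇒↭)
open import Data.List.Relation.Binary.Permutation.Propositional.Properties using (↭-length)
open import Data.Product using (_×_; ∃; ∃₂; _,_; proj₁; proj₂; uncurry)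
open import Data.Sum using (_⊎_; inj₁; inj₂)
open import Function.Base using (_∘′_)
open import Function.Bundles using (_⇔_; mk⇔; Equivalence)
import Function.Properties.Equivalence as ⇔
open import Relation.Nullary using (¬_; Dec; yes; no; contradiction)
open import Relation.Nullary.Decidable using (_×-dec_; ¬?)
open import Relation.Unary using (Decidable)
open import Relation.Binary.PropositionalEquality

divisor-of-prime-power : ∀ {p} → Prime p → ∀ e {d} →
  d ∣ p ^ suc e → ¬ (p ^ suc e ∣ d) → d ∣ p ^ e
divisor-of-prime-power {p} p-prime e {d} d∣p^e+1 p^e+1∤d with p ∣? d
... | no p∤d = coprime-divisor d⊥p d∣p^e+1
  where
  d⊥p : Coprime d p
  d⊥p {c} (c∣d , c∣p) with prime⇒irreducible p-prime c∣p
  ... | inj₁ c≡1  = c≡1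
  ... | inj₂ refl = contradiction c∣d p∤d
divisor-of-prime-power {p} p-prime zero {d} _ p^1∤d | yes p∣d =
  contradiction (subst (_∣ d) (sym (*-identityʳ p)) p∣d) p^1∤d
divisor-of-prime-power {p} p-prime (suc e) d∣p^e+2 p^e+2∤d | yes (divides d′ refl) =
  subst (d′ * p ∣_) (*-comm (p ^ e) p) (*-monoˡ-∣ p d′∣p^e)
  where
  instance p≢0 : NonZero p
           p≢0 = prime⇒nonZero p-prime
  -- d = d′·p with d′ ∣ p^(e+1) and p^(e+1) ∤ d′, so induction applies to d′
  d′∣p^e : d′ ∣ p ^ e
  d′∣p^e = divisor-of-prime-power p-prime e
    (*-cancelʳ-∣ p (subst (d′ * p ∣_) (*-comm p (p ^ suc e)) d∣p^e+2))
    λ p^e+1∣d′ → p^e+2∤d (subst (p ^ suc (suc e) ∣_) (*-comm p d′) (*-monoʳ-∣ p p^e+1∣d′))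

-- Two residues below N whose "difference" i - i' (computed as (N ∸ i') + i)
-- is a multiple of N are equal.
residues-equal : ∀ {N i i′} → i < N → i′ < N → N ∣ (N ∸ i′) + i → i ≡ i′
residues-equal {N} {i} {i′} i<N i′<N (divides c eq) = sym (begin
  i′               ≡⟨ m<n⇒m%n≡m i′<N ⟨
  i′ % N           ≡⟨ [m+kn]%n≡m%n i′ c N ⟨
  (i′ + c * N) % N ≡⟨ cong (_% N) shifted ⟩
  (i + 1 * N) % N  ≡⟨ [m+kn]%n≡m%n i 1 N ⟩
  i % N            ≡⟨ m<n⇒m%n≡m i<N ⟩
  i                ∎)
  where
  open ≡-Reasoning
  instance N≢0 : NonZero N
           N≢0 = >-nonZero (≤-<-trans z≤n i<N)
  shifted : i′ + c * N ≡ i + 1 * N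
  shifted = begin
    i′ + c * N         ≡⟨ cong (i′ +_) eq ⟨
    i′ + (N ∸ i′ + i)  ≡⟨ +-assoc i′ (N ∸ i′) i ⟨
    i′ + (N ∸ i′) + i  ≡⟨ cong (_+ i) (m+[n∸m]≡n (<⇒≤ i′<N)) ⟩
    N + i              ≡⟨ +-comm N i ⟩
    i + N              ≡⟨ cong (i +_) (*-identityˡ N) ⟨
    i + 1 * N          ∎

-- For p > 1, p^a ≤ p^b forces a ≤ b, hence p^a ∣ p^b.
power-≤⇒∣ : ∀ {p} → 1 < p → ∀ {a b} → p ^ a ≤ p ^ b → p ^ a ∣ p ^ b
power-≤⇒∣ {p} 1<p {a} {b} p^a≤p^b =
  subst (λ c → p ^ a ∣ p ^ c) (m+[n∸m]≡n a≤b)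
        (subst (p ^ a ∣_) (sym (^-distribˡ-+-* p a (b ∸ a))) (m∣m*n (p ^ (b ∸ a))))
  where
  a≤b : a ≤ b
  a≤b = ≮⇒≥ λ b<a → <⇒≱ (^-monoʳ-< p 1<p b<a) p^a≤p^b

switch-on : ∀ {Q : ℕ → Set} → Decidable Q → ¬ Q 0 → ∀ s → Q s → ∃ λ r → ¬ Q r × Q (suc r)
switch-on Q? ¬Q0 zero    Q0 = contradiction Q0 ¬Q0
switch-on Q? ¬Q0 (suc s) Qs+1 with Q? s
... | yes Qs = switch-on Q? ¬Q0 s Qs
... | no ¬Qs = s , ¬Qs , Qs+1

pair-injection⇒≤ : ∀ {m n k} (F : Fin m × Fin n → Fin k) →
  (∀ {x y} → F x ≡ F y → x ≡ y) → m * n ≤ k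
pair-injection⇒≤ {m} {n} F F-inj =
  injective⇒≤ {f = λ x → F (remQuot {m} n x)} λ {x} {y} eq → begin
    x                                 ≡⟨ combine-remQuot {m} n x ⟨
    uncurry combine (remQuot {m} n x) ≡⟨ cong (uncurry combine) (F-inj eq) ⟩
    uncurry combine (remQuot {m} n y) ≡⟨ combine-remQuot {m} n y ⟩
    y                                 ∎
  where open ≡-Reasoning

Fixed : ∀ {n} → Permutation′ n → ℕ → Fin n → Set
Fixed σ k x = pow σ k x ≡ x

module Powers {n} (σ : Permutation′ n) where
  open ≡-Reasoning

  pow-+ : ∀ a b → pow σ (a + b) ≗ pow σ a ∘′ pow σ b
  pow-+ zero    b y = refl
  pow-+ (suc a) b y = cong (σ ⟨$⟩ʳ_) (pow-+ a b y)

  fixed-* : ∀ {k x} → Fixed σ k x → ∀ q → Fixed σ (q * k) x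
  fixed-* fx zero    = refl
  fixed-* {k} {x} fx (suc q) = begin
    pow σ (k + q * k) x       ≡⟨ pow-+ k (q * k) x ⟩
    pow σ k (pow σ (q * k) x) ≡⟨ cong (pow σ k) (fixed-* fx q) ⟩
    pow σ k x                 ≡⟨ fx ⟩
    x                         ∎

  fixed-∣ : ∀ {k m x} → Fixed σ k x → k ∣ m → Fixed σ m x
  fixed-∣ fx (divides q refl) = fixed-* fx q

  powId-∣ : ∀ {k m} → PowId σ k → k ∣ m → PowId σ m
  powId-∣ idk k∣m y = fixed-∣ (idk y) k∣m

  powId? : Decidable (PowId σ)
  powId? k = all? λ y → pow σ k y ≟ᶠ y

  -- If d + b·l = a·k then σ^d x = σ^d (σ^(b·l) x) = σ^(a·k) x = x for any
  -- common fixed point x of σ^k and σ^l.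
  fixed-combination : ∀ {d k l x} a b → Fixed σ k x → Fixed σ l x →
    d + b * l ≡ a * k → Fixed σ d x
  fixed-combination {d} {k} {l} {x} a b fk fl eq = begin
    pow σ d x                 ≡⟨ cong (pow σ d) (fixed-* fl b) ⟨
    pow σ d (pow σ (b * l) x) ≡⟨ pow-+ d (b * l) x ⟨
    pow σ (d + b * l) x       ≡⟨ cong (λ t → pow σ t x) eq ⟩
    pow σ (a * k) x           ≡⟨ fixed-* fk a ⟩
    x                         ∎

  -- Common fixed points of σ^k and σ^l are fixed by σ^gcd(k,l) (Bézout).
  fixed-gcd : ∀ {k l x} → Fixed σ k x → Fixed σ l x → Fixed σ (gcd k l) x
  fixed-gcd {k} {l} fk fl with Bézout.identity (gcd-GCD k l)
  ... | Bézout.+- a b eq = fixed-combination a b fk fl eq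
  ... | Bézout.-+ a b eq = fixed-combination b a fl fk eq

  module _ {N} (order : HasOrder σ N) where
    private
      instance
        N≢0 : NonZero N
        N≢0 = >-nonZero (proj₁ order)
      σ^N≡1 : PowId σ N
      σ^N≡1 = proj₁ (proj₂ order)

    pow-mod : ∀ a → pow σ a ≗ pow σ (a % N)
    pow-mod a y = begin
      pow σ a y                           ≡⟨ cong (λ t → pow σ t y) (m≡m%n+[m/n]*n a N) ⟩
      pow σ (a % N + a / N * N) y         ≡⟨ pow-+ (a % N) _ y ⟩
      pow σ (a % N) (pow σ (a / N * N) y) ≡⟨ cong (pow σ (a % N)) (fixed-* (σ^N≡1 y) (a / N)) ⟩
      pow σ (a % N) y                     ∎

    order-∣ : ∀ {k} → PowId σ k → N ∣ k
    order-∣ {k} idk = m%n≡0⇒n∣m k N (remainder-zero (k % N) refl (m%n<n k N))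
      where
      remainder-zero : ∀ r → k % N ≡ r → r < N → r ≡ 0
      remainder-zero zero    _  _   = refl
      remainder-zero (suc r) eq r<N = contradiction
        (λ y → subst (λ t → Fixed σ t y) eq (trans (sym (pow-mod k y)) (idk y)))
        (proj₂ (proj₂ order) (suc r) (s≤s z≤n) r<N)

-- Let σ have order p^(e+1).  Then σ^(p^e) generates the unique subgroup of
-- order p of ⟨σ⟩, and its fixed points govern all the others.
module CyclicPGroup {n} (σ : Permutation′ n) {p} (p-prime : Prime p) (e : ℕ)
                    (order : HasOrder σ (p ^ suc e)) where
  open Powers σ

  private
    instance
      p≢0 : NonZero p
      p≢0 = prime⇒nonZero p-prime
    σ^order≡1 : PowId σ (p ^ suc e)
    σ^order≡1 = proj₁ (proj₂ order)

  -- A point fixed by some σ^k ≠ 1 is fixed by σ^(p^e): the exponent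
  -- gcd(k, p^(e+1)) fixes it and is a proper divisor of p^(e+1).
  fixed-by-nontrivial⇒fixed-by-p^e : ∀ k {x} → ¬ PowId σ k → Fixed σ k x → Fixed σ (p ^ e) x
  fixed-by-nontrivial⇒fixed-by-p^e k {x} σ^k≢1 fx =
    fixed-∣ {gcd k (p ^ suc e)} (fixed-gcd {k} {p ^ suc e} fx (σ^order≡1 x))
      (divisor-of-prime-power p-prime e (gcd[m,n]∣n k _)
        λ order∣gcd → σ^k≢1 (powId-∣ σ^order≡1 (∣-trans order∣gcd (gcd[m,n]∣m k _))))

  free⇔moved-by-p^e : ∀ x → FreePoint σ x ⇔ (¬ Fixed σ (p ^ e) x)
  free⇔moved-by-p^e x = mk⇔ free⇒moved moved⇒free
    where
    free⇒moved : FreePoint σ x → ¬ Fixed σ (p ^ e) x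
    free⇒moved free fx = proj₂ (proj₂ order) (p ^ e) (m^n>0 p e)
      (^-monoʳ-< p (nonTrivial⇒n>1 p {{prime⇒nonTrivial p-prime}}) (n<1+n e)) (free (p ^ e) fx)
    moved⇒free : ¬ Fixed σ (p ^ e) x → FreePoint σ x
    moved⇒free moved k fx with powId? k
    ... | yes σ^k≡1 = σ^k≡1
    ... | no  σ^k≢1 = contradiction (fixed-by-nontrivial⇒fixed-by-p^e k σ^k≢1 fx) moved

  -- An element σ^k of order p (σ^k ≠ 1 = σ^(pk)) lies in ⟨σ^(p^e)⟩, hence
  -- has the same fixed points as σ^(p^e).
  order-p⇒fixed⇔fixed-by-p^e : ∀ k → ¬ PowId σ k → PowId σ (p * k) →
    ∀ x → Fixed σ k x ⇔ Fixed σ (p ^ e) x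
  order-p⇒fixed⇔fixed-by-p^e k σ^k≢1 σ^pk≡1 x =
    mk⇔ (fixed-by-nontrivial⇒fixed-by-p^e k σ^k≢1) (λ fx → fixed-∣ {p ^ e} fx p^e∣k)
    where
    p^e∣k : p ^ e ∣ k
    p^e∣k = *-cancelˡ-∣ p (order-∣ order σ^pk≡1)

  order-p-power : ∀ i → ¬ PowId σ i →
    ∃ λ r → ¬ PowId σ (p ^ r * i) × PowId σ (p * (p ^ r * i))
  order-p-power i σ^i≢1 with switch-on {λ r → PowId σ (p ^ r * i)} (λ r → powId? (p ^ r * i))
      (λ σ^1i≡1 → σ^i≢1 (subst (PowId σ) (*-identityˡ i) σ^1i≡1))
      (suc e) (powId-∣ σ^order≡1 (m∣m*n {p ^ suc e} i))
  ... | r , σ^p^ri≢1 , σ^p^r+1i≡1 =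
    r , σ^p^ri≢1 , subst (PowId σ) (*-assoc p (p ^ r) i) σ^p^r+1i≡1

common-power-* : ∀ {n} (σ τ : Permutation′ n) i j → pow σ i ≗ pow τ j →
  ∀ q → pow σ (q * i) ≗ pow τ (q * j)
common-power-* σ τ i j E zero    y = refl
common-power-* σ τ i j E (suc q) y = begin
  pow σ (i + q * i) y       ≡⟨ Powers.pow-+ σ i (q * i) y ⟩
  pow σ i (pow σ (q * i) y) ≡⟨ cong (pow σ i) (common-power-* σ τ i j E q y) ⟩
  pow σ i (pow τ (q * j) y) ≡⟨ E _ ⟩
  pow τ j (pow τ (q * j) y) ≡⟨ Powers.pow-+ τ j (q * j) y ⟨
  pow τ (j + q * j) y       ∎
  where open ≡-Reasoning

-- If ⟨σ⟩ and ⟨τ⟩ (of orders p^(e+1), p^(f+1)) share an element σ^i = τ^j ≠ 1,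
-- they share their subgroup of order p, so σ^(p^e) and τ^(p^f) have the same
-- fixed points.
shared-order-p-subgroup : ∀ {n p} (σ τ : Permutation′ n) → Prime p → ∀ e f →
  HasOrder σ (p ^ suc e) → HasOrder τ (p ^ suc f) →
  ∀ i j → pow σ i ≗ pow τ j → ¬ PowId σ i →
  ∀ x → Fixed σ (p ^ e) x ⇔ Fixed τ (p ^ f) x
shared-order-p-subgroup {p = p} σ τ p-prime e f orderσ orderτ i j E σ^i≢1 x
  with CyclicPGroup.order-p-power σ p-prime e orderσ i σ^i≢1
... | r , c≢1 , c^p≡1 =
  ⇔.trans (⇔.sym (Cσ.order-p⇒fixed⇔fixed-by-p^e (p ^ r * i) c≢1 c^p≡1 x))
  (⇔.trans (mk⇔ (trans (sym (Ec x))) (trans (Ec x)))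
           (Cτ.order-p⇒fixed⇔fixed-by-p^e (p ^ r * j) c′≢1 c′^p≡1 x))
  where
  module Cσ = CyclicPGroup σ p-prime e orderσ
  module Cτ = CyclicPGroup τ p-prime f orderτ
  Ec : pow σ (p ^ r * i) ≗ pow τ (p ^ r * j)
  Ec = common-power-* σ τ i j E (p ^ r)
  c′≢1 : ¬ PowId τ (p ^ r * j)
  c′≢1 c′≡1 = c≢1 λ y → trans (Ec y) (c′≡1 y)
  c′^p≡1 : PowId τ (p * (p ^ r * j))
  c′^p≡1 y = trans (sym (common-power-* σ τ (p ^ r * i) (p ^ r * j) Ec p y)) (c^p≡1 y)

nontrivial-meet⇒same-free-points : ∀ {n p} (σ τ : Permutation′ n) → Prime p → ∀ e f →
  HasOrder σ (p ^ e) → HasOrder τ (p ^ f) →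
  ∀ i j → pow σ i ≗ pow τ j → ¬ PowId σ i →
  ∀ x → FreePoint σ x ⇔ FreePoint τ x
nontrivial-meet⇒same-free-points σ τ _ zero _ orderσ _ i _ _ σ^i≢1 =
  contradiction (Powers.powId-∣ σ {m = i} (proj₁ (proj₂ orderσ)) (1∣ i)) σ^i≢1
nontrivial-meet⇒same-free-points σ τ _ (suc _) zero _ orderτ _ j E σ^i≢1 =
  contradiction (λ y → trans (E y) (Powers.powId-∣ τ {m = j} (proj₁ (proj₂ orderτ)) (1∣ j) y)) σ^i≢1
nontrivial-meet⇒same-free-points σ τ p-prime (suc e) (suc f) orderσ orderτ i j E σ^i≢1 x =
  ⇔.trans (CyclicPGroup.free⇔moved-by-p^e σ p-prime e orderσ x)
  (⇔.trans (¬-cong (shared-order-p-subgroup σ τ p-prime e f orderσ orderτ i j E σ^i≢1 x))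
           (⇔.sym (CyclicPGroup.free⇔moved-by-p^e τ p-prime f orderτ x)))
  where
  ¬-cong : ∀ {A B : Set} → A ⇔ B → (¬ A) ⇔ (¬ B)
  ¬-cong A⇔B = mk⇔ (λ ¬a b → ¬a (Equivalence.from A⇔B b))
                   (λ ¬b a → ¬b (Equivalence.to A⇔B a))

same-free-points⇒same-count : ∀ {n} (σ τ : Permutation′ n) →
  (∀ x → FreePoint σ x ⇔ FreePoint τ x) → ∀ {a b} → NumFree σ a → NumFree τ b → a ≡ b
same-free-points⇒same-count σ τ free⇔
  (L , L-unique , L-spec , refl) (L′ , L′-unique , L′-spec , refl) =
  ↭-length (∼bag⇒↭ (unique∧set⇒bag L-unique L′-unique
    λ {x} → ⇔.trans (L-spec x) (⇔.trans (free⇔ x) (⇔.sym (L′-spec x)))))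

TrivialMeet : ∀ {n} → Permutation′ n → Permutation′ n → Set
TrivialMeet σ τ = ∀ i j → pow σ i ≗ pow τ j → PowId σ i

NontrivialMeet : ∀ {n} → Permutation′ n → Permutation′ n → Set
NontrivialMeet σ τ = ∃₂ λ i j → pow σ i ≗ pow τ j × ¬ PowId σ i

nontrivial-common-power? : ∀ {n} (σ τ : Permutation′ n) i j →
  Dec (pow σ i ≗ pow τ j × ¬ PowId σ i)
nontrivial-common-power? σ τ i j =
  all? (λ y → pow σ i y ≟ᶠ pow τ j y) ×-dec ¬? (Powers.powId? σ i)

-- One of the two always holds: exponents may be reduced modulo the orders,
-- which leaves finitely many candidate pairs (i, j) to search.
meet-dichotomy : ∀ {n N M} (σ τ : Permutation′ n) → HasOrder σ N → HasOrder τ M →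
  TrivialMeet σ τ ⊎ NontrivialMeet σ τ
meet-dichotomy {N = N} {M} σ τ orderσ orderτ
  with anyUpTo? (λ i → anyUpTo? (λ j → nontrivial-common-power? σ τ i j) M) N
... | yes (i , _ , j , _ , witness) = inj₂ (i , j , witness)
... | no no-witness = inj₁ trivial
  where
  instance
    N≢0 : NonZero N
    N≢0 = >-nonZero (proj₁ orderσ)
    M≢0 : NonZero M
    M≢0 = >-nonZero (proj₁ orderτ)
  trivial : TrivialMeet σ τ
  trivial i j E with Powers.powId? σ (i % N)
  ... | yes σ^[i%N]≡1 = λ y → trans (Powers.pow-mod σ orderσ i y) (σ^[i%N]≡1 y)
  ... | no  σ^[i%N]≢1 = contradiction
    (i % N , m%n<n i N , j % M , m%n<n j M , E-mod , σ^[i%N]≢1) no-witness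
    where
    E-mod : pow σ (i % N) ≗ pow τ (j % M)
    E-mod y = trans (sym (Powers.pow-mod σ orderσ i y))
                    (trans (E y) (Powers.pow-mod τ orderτ j y))

-- From σ^i τ^j = σ^i′ τ^j′ we get σ^(i - i′) = τ^(j′ - j), the differences
-- being represented as (N ∸ i′) + i and j′ + (M ∸ j) using σ^N = τ^M = 1.
difference-of-powers : ∀ {n N M} (σ τ : Permutation′ n) → PowId σ N → PowId τ M →
  ∀ i i′ j j′ → i′ ≤ N → j ≤ M → pow σ i ∘′ pow τ j ≗ pow σ i′ ∘′ pow τ j′ →
  pow σ (N ∸ i′ + i) ≗ pow τ (j′ + (M ∸ j))
difference-of-powers {n} {N} {M} σ τ σ^N≡1 τ^M≡1 i i′ j j′ i′≤N j≤M E z = begin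
  pow σ (N ∸ i′ + i) z                    ≡⟨ pow-+ σ (N ∸ i′) i z ⟩
  pow σ (N ∸ i′) (pow σ i z)              ≡⟨ cong (pow σ (N ∸ i′) ∘′ pow σ i) (τ-undo z) ⟨
  pow σ (N ∸ i′) (pow σ i (pow τ j z′))   ≡⟨ cong (pow σ (N ∸ i′)) (E z′) ⟩
  pow σ (N ∸ i′) (pow σ i′ (pow τ j′ z′)) ≡⟨ pow-+ σ (N ∸ i′) i′ _ ⟨
  pow σ (N ∸ i′ + i′) (pow τ j′ z′)       ≡⟨ cong (λ t → pow σ t (pow τ j′ z′)) (m∸n+n≡m i′≤N) ⟩
  pow σ N (pow τ j′ z′)                   ≡⟨ σ^N≡1 _ ⟩
  pow τ j′ (pow τ (M ∸ j) z)              ≡⟨ pow-+ τ j′ (M ∸ j) z ⟨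
  pow τ (j′ + (M ∸ j)) z                  ∎
  where
  open ≡-Reasoning
  open Powers using (pow-+)
  z′ : Fin n
  z′ = pow τ (M ∸ j) z
  τ-undo : ∀ z → pow τ j (pow τ (M ∸ j) z) ≡ z
  τ-undo z = begin
    pow τ j (pow τ (M ∸ j) z) ≡⟨ pow-+ τ j (M ∸ j) z ⟨
    pow τ (j + (M ∸ j)) z     ≡⟨ cong (λ t → pow τ t z) (m+[n∸m]≡n j≤M) ⟩
    pow τ M z                 ≡⟨ τ^M≡1 z ⟩
    z                         ∎

trivial-meet⇒exponents-determined : ∀ {n N M} (σ τ : Permutation′ n) → TrivialMeet σ τ →
  HasOrder σ N → HasOrder τ M → ∀ {i i′ j j′} → i < N → i′ < N → j < M → j′ < M →
  pow σ i ∘′ pow τ j ≗ pow σ i′ ∘′ pow τ j′ → i ≡ i′ × j ≡ j′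
trivial-meet⇒exponents-determined {N = N} {M} σ τ trivial orderσ orderτ {i} {i′} {j} {j′}
                                  i<N i′<N j<M j′<M E =
  residues-equal i<N i′<N (Powers.order-∣ σ orderσ σ^A≡1) ,
  sym (residues-equal j′<M j<M (Powers.order-∣ τ orderτ τ^B≡1))
  where
  E-diff : pow σ (N ∸ i′ + i) ≗ pow τ (j′ + (M ∸ j))
  E-diff = difference-of-powers σ τ (proj₁ (proj₂ orderσ)) (proj₁ (proj₂ orderτ))
             i i′ j j′ (<⇒≤ i′<N) (<⇒≤ j<M) E
  σ^A≡1 : PowId σ (N ∸ i′ + i)
  σ^A≡1 = trivial (N ∸ i′ + i) (j′ + (M ∸ j)) E-diff
  τ^B≡1 : PowId τ (M ∸ j + j′)
  τ^B≡1 y = subst (λ t → Fixed τ t y) (+-comm j′ (M ∸ j))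
                  (trans (sym (E-diff y)) (σ^A≡1 y))

powₚ : ∀ {n} → Permutation′ n → ℕ → Permutation′ n
powₚ σ zero    = id
powₚ σ (suc k) = powₚ σ k ∘ₚ σ

powₚ-applied : ∀ {n} (σ : Permutation′ n) k → powₚ σ k ⟨$⟩ʳ_ ≗ pow σ k
powₚ-applied σ zero    y = refl
powₚ-applied σ (suc k) y = cong (σ ⟨$⟩ʳ_) (powₚ-applied σ k y)

powₚ-∈ : ∀ {n} (G : PermGroup n) {σ} → σ ∈G G → ∀ k → powₚ σ k ∈G G
powₚ-∈ G σ∈G zero    = has-id G
powₚ-∈ G {σ} σ∈G (suc k) = closed-∘ G {powₚ σ k} {σ} (powₚ-∈ G σ∈G k) σ∈G

same-index⇒≈ : ∀ {n} {xs : List (Permutation′ n)} {π ρ}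
  (π∈ : Any (_≈ π) xs) (ρ∈ : Any (_≈ ρ) xs) → index π∈ ≡ index ρ∈ → π ≈ ρ
same-index⇒≈ {xs = xs} π∈ ρ∈ eq y =
  trans (sym (lookup-index π∈ y))
        (trans (cong (λ k → lookup xs k ⟨$⟩ʳ y) eq) (lookup-index ρ∈ y))

-- Trivial meet: (i, j) ↦ σ^i τ^j injects Fin N × Fin M into G, so N·M ≤ #G.
trivial-meet⇒order-product≤card : ∀ {n N M} (G : PermGroup n) (σ τ : Permutation′ n) →
  σ ∈G G → τ ∈G G → HasOrder σ N → HasOrder τ M → TrivialMeet σ τ → N * M ≤ card G
trivial-meet⇒order-product≤card {N = N} {M} G σ τ σ∈G τ∈G orderσ orderτ trivial =
  pair-injection⇒≤ position position-injective
  where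
  -- the permutation y ↦ σ^k (τ^l y)
  product : ℕ → ℕ → Permutation′ _
  product k l = powₚ τ l ∘ₚ powₚ σ k
  product-applied : ∀ k l → product k l ⟨$⟩ʳ_ ≗ pow σ k ∘′ pow τ l
  product-applied k l y =
    trans (powₚ-applied σ k _) (cong (pow σ k) (powₚ-applied τ l y))
  product-∈ : ∀ k l → product k l ∈G G
  product-∈ k l = closed-∘ G {powₚ τ l} {powₚ σ k} (powₚ-∈ G τ∈G l) (powₚ-∈ G σ∈G k)
  position : Fin N × Fin M → Fin (card G)
  position (i , j) = index (product-∈ (toℕ i) (toℕ j))
  position-injective : ∀ {x y} → position x ≡ position y → x ≡ y
  position-injective {i , j} {i′ , j′} eq =
    cong₂ _,_ (toℕ-injective (proj₁ same)) (toℕ-injective (proj₂ same))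
    where
    same : toℕ i ≡ toℕ i′ × toℕ j ≡ toℕ j′
    same = trivial-meet⇒exponents-determined σ τ trivial orderσ orderτ
      (toℕ<n i) (toℕ<n i′) (toℕ<n j) (toℕ<n j′) λ y →
      trans (sym (product-applied (toℕ i) (toℕ j) y))
        (trans (same-index⇒≈ {π = product (toℕ i) (toℕ j)} {ρ = product (toℕ i′) (toℕ j′)}
                 (product-∈ (toℕ i) (toℕ j)) (product-∈ (toℕ i′) (toℕ j′)) eq y)
               (product-applied (toℕ i′) (toℕ j′) y))

mainTheorem2 : (p n : ℕ) → Prime p → (G : PermGroup n) → IsPGroup p G →
    (σ τ : Permutation′ n) → σ ∈G G → τ ∈G G →
    (e f : ℕ) → HasOrder σ (p ^ e) → HasOrder τ (p ^ f) →
    (a b : ℕ) → NumFree σ a → NumFree τ b → a ≢ b →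
    (p ^ (e + f)) ∣ card G
mainTheorem2 p n p-prime G (k , #G≡p^k) σ τ σ∈G τ∈G e f orderσ orderτ a b freeσ freeτ a≢b
  with meet-dichotomy σ τ orderσ orderτ
... | inj₁ trivial = subst (p ^ (e + f) ∣_) (sym #G≡p^k)
  (power-≤⇒∣ (nonTrivial⇒n>1 p {{prime⇒nonTrivial p-prime}}) {e + f} {k} (begin
    p ^ (e + f)    ≡⟨ ^-distribˡ-+-* p e f ⟩
    p ^ e * p ^ f  ≤⟨ trivial-meet⇒order-product≤card G σ τ σ∈G τ∈G orderσ orderτ trivial ⟩
    card G         ≡⟨ #G≡p^k ⟩
    p ^ k          ∎))
  where open ≤-Reasoning
... | inj₂ (i , j , E , σ^i≢1) = contradiction
  (same-free-points⇒same-count σ τ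
    (nontrivial-meet⇒same-free-points σ τ p-prime e f orderσ orderτ i j E σ^i≢1) freeσ freeτ)
  a≢b
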